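{- The optimal value of (L.P.3) is at most the optimal cost of a prize-collecting connected $T$-join, i.e. at most $\min\{c(F)+\pi(I)\}$ over all $I\subseteq V\setminus T$ and connected $T$-joins $F$ of $G\setminus I$.
   Context: $G=(V,E)$ is an undirected graph with nonnegative edge costs $c_e$, $T\subseteq V$ with $|T|$ even and nonempty, and $\pi(v)\ge0$ is a penalty for each $v\in V\setminus T$; each node $v\in T$ is also given a (large) nonnegative penalty $\pi(v)$, and $\pi(X)=\sum_{v\in X}\pi(v)$. A connected $T$-join of a graph $H$ is a multiset $F$ of edges of $H$ such that $(V(H),F)$ is connected and its set of odd-degree nodes is exactly $T$; $c(F)$ counts multiplicities. Fix $t^\star\in T$; let $\mathcal Q$ be the $T$-odd subsets of $V\setminus\{t^\star\}$ and $\mathcal R$ the nonempty $T$-even subsets of $V\setminus\{t^\star\}$ ($T$-odd/even meaning $|S\cap T|$ odd/even); $\delta(S)$ is the set of edges with exactly one end in $S$. (L.P.3) has variables $x_e$ ($e\in E$) and $Z_X$ ($X\subseteq V\setminus\{t^\star\}$): minimize $\sum_e c_ex_e+\sum_{X\subseteq V\setminus\{t^\star\}}\pi(X)Z_X$ subject to $x(\delta(Q))\ge1$ for all $Q\in\mathcal Q$; $x(\delta(R))+\sum_{X:\,R\subseteq X\subseteq V\setminus\{t^\star\}}2Z_X\ge 2$ for all $R\in\mathcal R$; $x,Z\ge 0$.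
   Formalization: The edge costs $c_e$ and the penalties $\pi(v)$ take values in the rationals, and the variables $x_e$ and $Z_X$ of (L.P.3) are taken in ℚ. -}

module Defs where

open import Data.Nat as ℕ using (ℕ; zero; suc)
open import Data.Nat.Divisibility using (_∣_)
open import Data.Integer using (+_)
open import Data.Rational using (ℚ; 0ℚ; _+_; _*_; _/_)
open import Data.Bool using (Bool; true; false; if_then_else_; _xor_)
open import Data.Fin using (Fin; zero; suc; _≟_)
open import Data.Fin.Subset using (Subset; _∉_)
open import Data.Vec using (_∷_; []; lookup)
open import Data.Product using (_×_)
open import Data.Sum using (_⊎_)
open import Relation.Nullary using (¬_)
open import Relation.Nullary.Decidable using (⌊_⌋)
open import Relation.Binary.PropositionalEquality using (_≡_; _≢_)

ℕ→ℚ : ℕ → ℚ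
ℕ→ℚ k = (+ k) / 1

sumℚ : ∀ {m} → (Fin m → ℚ) → ℚ
sumℚ {zero} f = 0ℚ
sumℚ {suc m} f = f zero + sumℚ (λ i → f (suc i))

sumℕ : ∀ {m} → (Fin m → ℕ) → ℕ
sumℕ {zero} f = 0
sumℕ {suc m} f = f zero ℕ.+ sumℕ (λ i → f (suc i))

sumSubsets : ∀ {n} → (Subset n → ℚ) → ℚ
sumSubsets {zero} f = f []
sumSubsets {suc n} f = sumSubsets (λ p → f (true ∷ p)) + sumSubsets (λ p → f (false ∷ p))

Odd : ℕ → Set
Odd k = ¬ (2 ∣ k)

Even : ℕ → Set
Even k = 2 ∣ k

-- An undirected (multi)graph on vertex set Fin n with edges Fin m;
-- edge e has ends src e and tgt e.
module Graph {n m : ℕ} (src tgt : Fin m → Fin n) where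

  inδ : Subset n → Fin m → Bool
  inδ S e = lookup S (src e) xor lookup S (tgt e)

  xδ : (Fin m → ℚ) → Subset n → ℚ
  xδ x S = sumℚ (λ e → if inδ S e then x e else 0ℚ)

  weight : (Fin n → ℚ) → Subset n → ℚ
  weight π X = sumℚ (λ v → if lookup X v then π v else 0ℚ)

  -- c(F) counting multiplicities; F is a multiset of edges (multiplicity function)
  costF : (Fin m → ℚ) → (Fin m → ℕ) → ℚ
  costF c F = sumℚ (λ e → c e * ℕ→ℚ (F e))

  -- degree of v in multiset F (a loop counts twice)
  deg : (Fin m → ℕ) → Fin n → ℕ
  deg F v = sumℕ (λ e → F e ℕ.* ((if ⌊ src e ≟ v ⌋ then 1 else 0) ℕ.+ (if ⌊ tgt e ≟ v ⌋ then 1 else 0)))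

  data Reach (F : Fin m → ℕ) (u : Fin n) : Fin n → Set where
    here : Reach F u u
    step : ∀ {v w} (e : Fin m) → Reach F u v → F e ≢ 0 →
           ((src e ≡ v × tgt e ≡ w) ⊎ (tgt e ≡ v × src e ≡ w)) → Reach F u w

  ConnectedTJoin : Subset n → Subset n → (Fin m → ℕ) → Set
  ConnectedTJoin T I F =
      (∀ e → F e ≢ 0 → src e ∉ I × tgt e ∉ I)
    × (∀ v w → v ∉ I → w ∉ I → Reach F v w)
    × (∀ v → v ∉ I → (Odd (deg F v) → lookup T v ≡ true) × (lookup T v ≡ true → Odd (deg F v)))

-- Take the join itself as the primal point: x e is the multiplicity F e, and Z is the
-- indicator of the single set I (which avoids t⋆ because t⋆ ∈ T and I ∩ T = ∅). Its
-- objective is exactly c(F) + π(I). By the handshake lemma F(δ(S)) ≡ Σ_{v∈S} deg v ≡ |S ∩ T|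
-- (mod 2), since the odd-degree nodes are exactly T and nodes of I are isolated. Hence every
-- T-odd cut is crossed at least once, and every T-even cut is crossed 0 or ≥ 2 times. A
-- T-even set R ∌ t⋆ with F(δ(R)) = 0 lies inside I, because each node outside I is joined
-- to t⋆ by an F-path, which would have to leave R; then Z_I pays for R's constraint.
module Submission where

open import Defs
open import Data.Nat using (ℕ)
open import Data.Rational using (ℚ; 0ℚ; 1ℚ; _+_; _*_; _≤_)
open import Data.Bool using (true; false; if_then_else_)
open import Data.Fin using (Fin)
open import Data.Fin.Subset using (Subset; _∈_; _∉_; _⊆_; _∩_; ∣_∣; Nonempty; ∁)
open import Data.Vec using (lookup)
open import Data.Product using (Σ; _×_; _,_)
open import Relation.Nullary using (¬_)
open import Relation.Nullary.Decidable using (⌊_⌋)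
open import Data.Fin.Subset.Properties using (_⊆?_)

open import Algebra.Bundles using (CommutativeRing)
open import Data.Nat as ℕ using (zero; suc; z≤n; s≤s)
import Data.Nat.Properties as ℕP
open import Data.Nat.Divisibility using (divides)
import Data.Nat.Coprimality as Coprime
import Data.Integer as ℤ
import Data.Integer.Properties as ℤP
open import Data.Rational using (mkℚ; *≤*; _/_)
import Data.Rational.Properties as ℚP
open import Data.Bool using (Bool; not; _∧_; _xor_)
open import Data.Bool.Properties as BoolP using (xor-∧-commutativeRing)
open import Data.Fin using (zero; suc; _≟_)
open import Data.Fin.Subset.Properties using (x∈p⇒x∉∁p; x∈∁p⇒x∉p)
open import Data.Vec using (_∷_; [])
import Data.Vec.Properties as VecP
open import Data.Product using (uncurry; proj₁; proj₂)
open import Data.Sum using (_⊎_; inj₁; inj₂)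
open import Data.Empty using (⊥-elim)
open import Relation.Nullary using (Dec; yes; no)
open import Relation.Nullary.Decidable using (isYes≗does; dec-true; dec-false; ⌊⌋-map′)
open import Function.Bundles using (mk⇔)
open import Relation.Binary.PropositionalEquality
  using (_≡_; _≢_; refl; sym; trans; cong; cong₂; subst; subst₂; module ≡-Reasoning)

open import Algebra.Properties.Semiring.Sum (CommutativeRing.semiring xor-∧-commutativeRing)
  using (∑-comm; ∑-distrib-+; *-distribʳ-sum; sum-cong-≗; sum-replicate-zero)
  renaming (sum to xorSum)

⌊⌋-true : ∀ {a} {A : Set a} (a? : Dec A) → A → ⌊ a? ⌋ ≡ true
⌊⌋-true a? a = trans (isYes≗does a?) (dec-true a? a)

⌊⌋-false : ∀ {a} {A : Set a} (a? : Dec A) → ¬ A → ⌊ a? ⌋ ≡ false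
⌊⌋-false a? ¬a = trans (isYes≗does a?) (dec-false a? ¬a)

∉⇒lookup≡false : ∀ {n} {v : Fin n} {p : Subset n} → v ∉ p → lookup p v ≡ false
∉⇒lookup≡false {v = v} {p} v∉p with lookup p v in eq
... | true  = ⊥-elim (v∉p (VecP.lookup⇒[]= v p eq))
... | false = refl

lookup≡false⇒∉ : ∀ {n} {v : Fin n} {p : Subset n} → lookup p v ≡ false → v ∉ p
lookup≡false⇒∉ eq v∈p with trans (sym (VecP.[]=⇒lookup v∈p)) eq
... | ()

ℕ→ℚ≡mkℚ : ∀ k → ℕ→ℚ k ≡ mkℚ (ℤ.+ k) 0 (Coprime.sym (Coprime.1-coprimeTo k))
ℕ→ℚ≡mkℚ k = ℚP.normalize-coprime (Coprime.sym (Coprime.1-coprimeTo k))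

ℕ→ℚ-homo-+ : ∀ a b → ℕ→ℚ (a ℕ.+ b) ≡ ℕ→ℚ a + ℕ→ℚ b
ℕ→ℚ-homo-+ a b rewrite ℕ→ℚ≡mkℚ a | ℕ→ℚ≡mkℚ b =
  cong (_/ 1)
    (sym (trans (cong₂ ℤ._+_ (ℤP.*-identityʳ (ℤ.+ a)) (ℤP.*-identityʳ (ℤ.+ b))) (sym (ℤP.pos-+ a b))))

ℕ→ℚ-mono-≤ : ∀ {a b} → a ℕ.≤ b → ℕ→ℚ a ≤ ℕ→ℚ b
ℕ→ℚ-mono-≤ {a} {b} a≤b rewrite ℕ→ℚ≡mkℚ a | ℕ→ℚ≡mkℚ b =
  *≤* (subst₂ ℤ._≤_ (sym (ℤP.*-identityʳ (ℤ.+ a))) (sym (ℤP.*-identityʳ (ℤ.+ b))) (ℤ.+≤+ a≤b))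

ℕ→ℚ-nonNeg : ∀ k → 0ℚ ≤ ℕ→ℚ k
ℕ→ℚ-nonNeg k = ℕ→ℚ-mono-≤ {0} {k} z≤n

sumℚ-ℕ→ℚ : ∀ {k} (f : Fin k → ℕ) → sumℚ (λ i → ℕ→ℚ (f i)) ≡ ℕ→ℚ (sumℕ f)
sumℚ-ℕ→ℚ {zero}  f = refl
sumℚ-ℕ→ℚ {suc k} f =
  trans (cong (ℕ→ℚ (f zero) +_) (sumℚ-ℕ→ℚ (λ i → f (suc i)))) (sym (ℕ→ℚ-homo-+ (f zero) _))

sumℚ-cong : ∀ {k} {f g : Fin k → ℚ} → (∀ i → f i ≡ g i) → sumℚ f ≡ sumℚ g
sumℚ-cong {zero}  f≗g = refl
sumℚ-cong {suc k} f≗g = cong₂ _+_ (f≗g zero) (sumℚ-cong (λ i → f≗g (suc i)))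

term≤sumℕ : ∀ {k} (f : Fin k → ℕ) i → f i ℕ.≤ sumℕ f
term≤sumℕ f zero    = ℕP.m≤m+n (f zero) _
term≤sumℕ f (suc i) = ℕP.≤-trans (term≤sumℕ (λ j → f (suc j)) i) (ℕP.m≤n+m _ (f zero))

sumℕ-zero : ∀ {k} (f : Fin k → ℕ) → (∀ i → f i ≡ 0) → sumℕ f ≡ 0
sumℕ-zero {zero}  f f≗0 = refl
sumℕ-zero {suc k} f f≗0 = cong₂ ℕ._+_ (f≗0 zero) (sumℕ-zero (λ i → f (suc i)) (λ i → f≗0 (suc i)))

≤-+-nonNegˡ : ∀ {p q r} → 0ℚ ≤ p → q ≤ r → q ≤ p + r
≤-+-nonNegˡ {p} {q} {r} 0≤p q≤r = subst (_≤ p + r) (ℚP.+-identityˡ q) (ℚP.+-mono-≤ 0≤p q≤r)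

≤-+-nonNegʳ : ∀ {p q r} → 0ℚ ≤ r → q ≤ p → q ≤ p + r
≤-+-nonNegʳ {p} {q} {r} 0≤r q≤p = subst (_≤ p + r) (ℚP.+-identityʳ q) (ℚP.+-mono-≤ q≤p 0≤r)

sumSubsets-nonNeg : ∀ {n} (f : Subset n → ℚ) → (∀ X → 0ℚ ≤ f X) → 0ℚ ≤ sumSubsets f
sumSubsets-nonNeg {zero}  f 0≤f = 0≤f []
sumSubsets-nonNeg {suc n} f 0≤f =
  ≤-+-nonNegˡ (sumSubsets-nonNeg (λ X → f (true ∷ X)) (λ X → 0≤f _))
              (sumSubsets-nonNeg (λ X → f (false ∷ X)) (λ X → 0≤f _))

term≤sumSubsets : ∀ {n} (f : Subset n → ℚ) → (∀ X → 0ℚ ≤ f X) → ∀ I → f I ≤ sumSubsets f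
term≤sumSubsets {zero}  f 0≤f [] = ℚP.≤-refl
term≤sumSubsets {suc n} f 0≤f (true ∷ I) =
  ≤-+-nonNegʳ (sumSubsets-nonNeg (λ X → f (false ∷ X)) (λ X → 0≤f _))
              (term≤sumSubsets (λ X → f (true ∷ X)) (λ X → 0≤f _) I)
term≤sumSubsets {suc n} f 0≤f (false ∷ I) =
  ≤-+-nonNegˡ (sumSubsets-nonNeg (λ X → f (true ∷ X)) (λ X → 0≤f _))
              (term≤sumSubsets (λ X → f (false ∷ X)) (λ X → 0≤f _) I)

sumSubsets-zero : ∀ {n} (f : Subset n → ℚ) → (∀ X → f X ≡ 0ℚ) → sumSubsets f ≡ 0ℚ
sumSubsets-zero {zero}  f f≗0 = f≗0 []
sumSubsets-zero {suc n} f f≗0 =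
  cong₂ _+_ (sumSubsets-zero (λ X → f (true ∷ X)) (λ X → f≗0 _))
            (sumSubsets-zero (λ X → f (false ∷ X)) (λ X → f≗0 _))

sumSubsets-concentrated : ∀ {n} (f : Subset n → ℚ) I → (∀ X → X ≢ I → f X ≡ 0ℚ) → sumSubsets f ≡ f I
sumSubsets-concentrated {zero} f [] _ = refl
sumSubsets-concentrated {suc n} f (true ∷ I) f≗0 = begin
  sumSubsets (λ X → f (true ∷ X)) + sumSubsets (λ X → f (false ∷ X))
    ≡⟨ cong₂ _+_ (sumSubsets-concentrated (λ X → f (true ∷ X)) I (λ X X≢I → f≗0 _ (λ { refl → X≢I refl })))
                 (sumSubsets-zero (λ X → f (false ∷ X)) (λ X → f≗0 _ (λ ()))) ⟩
  f (true ∷ I) + 0ℚ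
    ≡⟨ ℚP.+-identityʳ _ ⟩
  f (true ∷ I) ∎
  where open ≡-Reasoning
sumSubsets-concentrated {suc n} f (false ∷ I) f≗0 = begin
  sumSubsets (λ X → f (true ∷ X)) + sumSubsets (λ X → f (false ∷ X))
    ≡⟨ cong₂ _+_ (sumSubsets-zero (λ X → f (true ∷ X)) (λ X → f≗0 _ (λ ())))
                 (sumSubsets-concentrated (λ X → f (false ∷ X)) I (λ X X≢I → f≗0 _ (λ { refl → X≢I refl }))) ⟩
  0ℚ + f (false ∷ I)
    ≡⟨ ℚP.+-identityˡ _ ⟩
  f (false ∷ I) ∎
  where open ≡-Reasoning

pointMass : ∀ {n} → Subset n → Subset n → ℚ
pointMass I X = if ⌊ VecP.≡-dec BoolP._≟_ X I ⌋ then 1ℚ else 0ℚ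

pointMass-nonNeg : ∀ {n} (I X : Subset n) → 0ℚ ≤ pointMass I X
pointMass-nonNeg I X with ⌊ VecP.≡-dec BoolP._≟_ X I ⌋
... | true  = *≤* (ℤ.+≤+ z≤n)
... | false = ℚP.≤-refl

pointMass-at : ∀ {n} (I : Subset n) → pointMass I I ≡ 1ℚ
pointMass-at I rewrite ⌊⌋-true (VecP.≡-dec BoolP._≟_ I I) refl = refl

pointMass-off : ∀ {n} {I X : Subset n} → X ≢ I → pointMass I X ≡ 0ℚ
pointMass-off {I = I} {X} X≢I rewrite ⌊⌋-false (VecP.≡-dec BoolP._≟_ X I) X≢I = refl

-- Parity, with values in the ring (Bool, xor, ∧)

isOdd : ℕ → Bool
isOdd zero    = false
isOdd (suc k) = not (isOdd k)

isOdd-homo-+ : ∀ a b → isOdd (a ℕ.+ b) ≡ isOdd a xor isOdd b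
isOdd-homo-+ zero    b = refl
isOdd-homo-+ (suc a) b rewrite isOdd-homo-+ a b = BoolP.not-distribˡ-xor (isOdd a) (isOdd b)

isOdd-homo-* : ∀ a b → isOdd (a ℕ.* b) ≡ isOdd a ∧ isOdd b
isOdd-homo-* zero    b = refl
isOdd-homo-* (suc a) b rewrite isOdd-homo-+ b (a ℕ.* b) | isOdd-homo-* a b with isOdd a | isOdd b
... | true  | y = BoolP.xor-same y
... | false | y = BoolP.xor-identityʳ y

isOdd-if : ∀ b k → isOdd (if b then k else 0) ≡ b ∧ isOdd k
isOdd-if true  k = refl
isOdd-if false k = refl

isOdd-indicator : ∀ b → isOdd (if b then 1 else 0) ≡ b
isOdd-indicator true  = refl
isOdd-indicator false = refl

isOdd≡false⇒Even : ∀ k → isOdd k ≡ false → Even k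
isOdd≡false⇒Even zero          _ = divides 0 refl
isOdd≡false⇒Even (suc zero)    ()
isOdd≡false⇒Even (suc (suc k)) eq rewrite BoolP.not-involutive (isOdd k)
  with isOdd≡false⇒Even k eq
... | divides q k≡q*2 = divides (suc q) (cong (λ j → suc (suc j)) k≡q*2)

Even⇒isOdd≡false : ∀ k → Even k → isOdd k ≡ false
Even⇒isOdd≡false _ (divides q refl) rewrite isOdd-homo-* q 2 = BoolP.∧-zeroʳ (isOdd q)

Odd⇒isOdd≡true : ∀ k → Odd k → isOdd k ≡ true
Odd⇒isOdd≡true k odd with isOdd k in eq
... | true  = refl
... | false = ⊥-elim (odd (isOdd≡false⇒Even k eq))

isOdd≡true⇒Odd : ∀ k → isOdd k ≡ true → Odd k
isOdd≡true⇒Odd k eq even with trans (sym eq) (Even⇒isOdd≡false k even)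
... | ()

isOdd⇒1≤ : ∀ {k} → isOdd k ≡ true → 1 ℕ.≤ k
isOdd⇒1≤ {suc k} _ = s≤s z≤n

Even⇒≡0⊎2≤ : ∀ {k} → Even k → k ≡ 0 ⊎ 2 ℕ.≤ k
Even⇒≡0⊎2≤ (divides zero    refl) = inj₁ refl
Even⇒≡0⊎2≤ (divides (suc q) refl) = inj₂ (s≤s (s≤s z≤n))

isOdd-sumℕ : ∀ {k} (f : Fin k → ℕ) → isOdd (sumℕ f) ≡ xorSum (λ i → isOdd (f i))
isOdd-sumℕ {zero}  f = refl
isOdd-sumℕ {suc k} f rewrite isOdd-homo-+ (f zero) (sumℕ (λ i → f (suc i))) =
  cong (isOdd (f zero) xor_) (isOdd-sumℕ (λ i → f (suc i)))

isOdd-∣∣ : ∀ {n} (p : Subset n) → isOdd ∣ p ∣ ≡ xorSum (lookup p)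
isOdd-∣∣ []          = refl
isOdd-∣∣ (true ∷ p)  rewrite isOdd-∣∣ p = refl
isOdd-∣∣ (false ∷ p) rewrite isOdd-∣∣ p = refl

xorSum-select : ∀ {n} (g : Fin n → Bool) a → xorSum (λ v → g v ∧ ⌊ a ≟ v ⌋) ≡ g a
xorSum-select {suc n} g zero = begin
  (g zero ∧ true) xor xorSum (λ v → g (suc v) ∧ false)
    ≡⟨ cong₂ _xor_ (BoolP.∧-identityʳ (g zero))
         (trans (sum-cong-≗ (λ v → BoolP.∧-zeroʳ (g (suc v)))) (sum-replicate-zero n)) ⟩
  g zero xor false
    ≡⟨ BoolP.xor-identityʳ (g zero) ⟩
  g zero ∎
  where open ≡-Reasoning
xorSum-select {suc n} g (suc a) rewrite BoolP.∧-zeroʳ (g zero) =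
  trans (sum-cong-≗ (λ v → cong (g (suc v) ∧_) (⌊⌋-map′ _ _ (a ≟ v)))) (xorSum-select (λ v → g (suc v)) a)

module Cuts {n m : ℕ} (src tgt : Fin m → Fin n) where
  open Graph src tgt

  cut : (Fin m → ℕ) → Subset n → ℕ
  cut F S = sumℕ (λ e → if inδ S e then F e else 0)

  xδ-ℕ→ℚ : ∀ F S → xδ (λ e → ℕ→ℚ (F e)) S ≡ ℕ→ℚ (cut F S)
  xδ-ℕ→ℚ F S =
    trans (sumℚ-cong (λ e → sym (BoolP.if-float ℕ→ℚ (inδ S e)))) (sumℚ-ℕ→ℚ (λ e → if inδ S e then F e else 0))

  endCount : Fin m → Fin n → ℕ
  endCount e v = (if ⌊ src e ≟ v ⌋ then 1 else 0) ℕ.+ (if ⌊ tgt e ≟ v ⌋ then 1 else 0)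

  incident : Fin m → Fin n → Bool
  incident e v = ⌊ src e ≟ v ⌋ xor ⌊ tgt e ≟ v ⌋

  isOdd-deg : ∀ F v → isOdd (deg F v) ≡ xorSum (λ e → incident e v ∧ isOdd (F e))
  isOdd-deg F v = trans (isOdd-sumℕ (λ e → F e ℕ.* endCount e v))
                        (sum-cong-≗ λ e → begin
    isOdd (F e ℕ.* endCount e v)
      ≡⟨ isOdd-homo-* (F e) (endCount e v) ⟩
    isOdd (F e) ∧ isOdd (endCount e v)
      ≡⟨ cong (isOdd (F e) ∧_) (trans (isOdd-homo-+ (if ⌊ src e ≟ v ⌋ then 1 else 0) (if ⌊ tgt e ≟ v ⌋ then 1 else 0))
           (cong₂ _xor_ (isOdd-indicator ⌊ src e ≟ v ⌋) (isOdd-indicator ⌊ tgt e ≟ v ⌋))) ⟩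
    isOdd (F e) ∧ incident e v
      ≡⟨ BoolP.∧-comm (isOdd (F e)) _ ⟩
    incident e v ∧ isOdd (F e) ∎)
    where open ≡-Reasoning

  xorSum-incident : ∀ (S : Subset n) e → xorSum (λ v → lookup S v ∧ incident e v) ≡ inδ S e
  xorSum-incident S e = begin
    xorSum (λ v → lookup S v ∧ incident e v)
      ≡⟨ sum-cong-≗ (λ v → BoolP.∧-distribˡ-xor (lookup S v) _ _) ⟩
    xorSum (λ v → (lookup S v ∧ ⌊ src e ≟ v ⌋) xor (lookup S v ∧ ⌊ tgt e ≟ v ⌋))
      ≡⟨ ∑-distrib-+ (λ v → lookup S v ∧ ⌊ src e ≟ v ⌋) (λ v → lookup S v ∧ ⌊ tgt e ≟ v ⌋) ⟩
    xorSum (λ v → lookup S v ∧ ⌊ src e ≟ v ⌋) xor xorSum (λ v → lookup S v ∧ ⌊ tgt e ≟ v ⌋)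
      ≡⟨ cong₂ _xor_ (xorSum-select (lookup S) (src e)) (xorSum-select (lookup S) (tgt e)) ⟩
    inδ S e ∎
    where open ≡-Reasoning

  -- Handshake lemma mod 2: each edge contributes to the degree sum over S once per end in S.
  isOdd-cut : ∀ F S → isOdd (cut F S) ≡ xorSum (λ v → lookup S v ∧ isOdd (deg F v))
  isOdd-cut F S = sym (begin
    xorSum (λ v → lookup S v ∧ isOdd (deg F v))
      ≡⟨ sum-cong-≗ (λ v → cong (lookup S v ∧_) (isOdd-deg F v)) ⟩
    xorSum (λ v → lookup S v ∧ xorSum (λ e → incident e v ∧ isOdd (F e)))
      ≡⟨ sum-cong-≗ (λ v → lookup-distrib v) ⟩
    xorSum (λ v → xorSum (λ e → (lookup S v ∧ incident e v) ∧ isOdd (F e)))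
      ≡⟨ ∑-comm (λ v e → (lookup S v ∧ incident e v) ∧ isOdd (F e)) ⟩
    xorSum (λ e → xorSum (λ v → (lookup S v ∧ incident e v) ∧ isOdd (F e)))
      ≡⟨ sum-cong-≗ (λ e → trans (sym (*-distribʳ-sum (isOdd (F e)) (λ v → lookup S v ∧ incident e v)))
                                 (cong (_∧ isOdd (F e)) (xorSum-incident S e))) ⟩
    xorSum (λ e → inδ S e ∧ isOdd (F e))
      ≡⟨ sym (trans (isOdd-sumℕ (λ e → if inδ S e then F e else 0)) (sum-cong-≗ (λ e → isOdd-if (inδ S e) (F e)))) ⟩
    isOdd (cut F S) ∎)
    where
      open ≡-Reasoning
      lookup-distrib : ∀ v → lookup S v ∧ xorSum (λ e → incident e v ∧ isOdd (F e))
                           ≡ xorSum (λ e → (lookup S v ∧ incident e v) ∧ isOdd (F e))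
      lookup-distrib v with lookup S v
      ... | true  = refl
      ... | false = sym (sum-replicate-zero m)

  endCount≡0 : ∀ {e v} → src e ≢ v → tgt e ≢ v → endCount e v ≡ 0
  endCount≡0 {e} {v} src≢v tgt≢v rewrite ⌊⌋-false (src e ≟ v) src≢v | ⌊⌋-false (tgt e ≟ v) tgt≢v = refl

  deg-isolated : ∀ F v → (∀ e → F e ≢ 0 → src e ≢ v × tgt e ≢ v) → deg F v ≡ 0
  deg-isolated F v avoid = sumℕ-zero (λ e → F e ℕ.* endCount e v) term≡0
    where
      term≡0 : ∀ e → F e ℕ.* endCount e v ≡ 0
      term≡0 e with F e ℕ.≟ 0
      ... | yes Fe≡0 = cong (ℕ._* endCount e v) Fe≡0
      ... | no  Fe≢0 = trans (cong (F e ℕ.*_) (uncurry endCount≡0 (avoid e Fe≢0))) (ℕP.*-zeroʳ (F e))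

  reach⇒crossing : ∀ {F u w} (S : Subset n) → Reach F u w → lookup S u ≡ true → lookup S w ≡ false →
                   Σ (Fin m) λ e → F e ≢ 0 × inδ S e ≡ true
  reach⇒crossing S here Su Sw with trans (sym Su) Sw
  ... | ()
  reach⇒crossing {w = w} S (step {v} e r Fe≢0 ends) Su Sw with lookup S v in Sv
  ... | false = reach⇒crossing S r Su Sv
  ... | true  = e , Fe≢0 , crossing ends
    where
      crossing : (src e ≡ v × tgt e ≡ w) ⊎ (tgt e ≡ v × src e ≡ w) → inδ S e ≡ true
      crossing (inj₁ (refl , refl)) rewrite Sv | Sw = refl
      crossing (inj₂ (refl , refl)) rewrite Sv | Sw = refl

  crossing⇒1≤cut : ∀ {F} S e → F e ≢ 0 → inδ S e ≡ true → 1 ℕ.≤ cut F S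
  crossing⇒1≤cut {F} S e Fe≢0 e∈δS = ℕP.≤-trans (ℕP.n≢0⇒n>0 Fe≢0)
    (subst (ℕ._≤ cut F S) (cong (λ b → if b then F e else 0) e∈δS)
      (term≤sumℕ (λ e → if inδ S e then F e else 0) e))

module ConnectedTJoins {n m : ℕ} (src tgt : Fin m → Fin n) {T I : Subset n} {F : Fin m → ℕ}
                       (I⊆∁T : I ⊆ ∁ T) (join : Graph.ConnectedTJoin src tgt T I F) where
  open Graph src tgt
  open Cuts src tgt

  private
    avoidsI : ∀ e → F e ≢ 0 → src e ∉ I × tgt e ∉ I
    avoidsI = proj₁ join

    connected : ∀ v w → v ∉ I → w ∉ I → Reach F v w
    connected = proj₁ (proj₂ join)

    oddDegrees : ∀ v → v ∉ I → (Odd (deg F v) → lookup T v ≡ true) × (lookup T v ≡ true → Odd (deg F v))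
    oddDegrees = proj₂ (proj₂ join)

  isOdd-deg≡T : ∀ v → isOdd (deg F v) ≡ lookup T v
  isOdd-deg≡T v with lookup I v in Iv
  ... | true = trans (cong isOdd (deg-isolated F v avoid)) (sym (∉⇒lookup≡false (x∈∁p⇒x∉p (I⊆∁T v∈I))))
    where
      v∈I : v ∈ I
      v∈I = VecP.lookup⇒[]= v I Iv

      avoid : ∀ e → F e ≢ 0 → src e ≢ v × tgt e ≢ v
      avoid e Fe≢0 with avoidsI e Fe≢0
      ... | src∉I , tgt∉I = (λ { refl → src∉I v∈I }) , (λ { refl → tgt∉I v∈I })
  ... | false with oddDegrees v (lookup≡false⇒∉ Iv)
  ...   | odd⇒T , T⇒odd = BoolP.⇔→≡ (mk⇔ (λ odd → odd⇒T (isOdd≡true⇒Odd _ odd))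
                                         (λ inT → Odd⇒isOdd≡true _ (T⇒odd inT)))

  isOdd-cut≡isOdd-∣∩T∣ : ∀ S → isOdd (cut F S) ≡ isOdd ∣ S ∩ T ∣
  isOdd-cut≡isOdd-∣∩T∣ S = begin
    isOdd (cut F S)
      ≡⟨ isOdd-cut F S ⟩
    xorSum (λ v → lookup S v ∧ isOdd (deg F v))
      ≡⟨ sum-cong-≗ (λ v → trans (cong (lookup S v ∧_) (isOdd-deg≡T v)) (sym (VecP.lookup-zipWith _∧_ v S T))) ⟩
    xorSum (lookup (S ∩ T))
      ≡⟨ isOdd-∣∣ (S ∩ T) ⟨
    isOdd ∣ S ∩ T ∣ ∎
    where open ≡-Reasoning

  cut≡0⇒⊆ : ∀ {t S} → t ∉ I → t ∉ S → cut F S ≡ 0 → S ⊆ I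
  cut≡0⇒⊆ {t} {S} t∉I t∉S cut≡0 {v} v∈S with lookup I v in Iv
  ... | true  = VecP.lookup⇒[]= v I Iv
  ... | false with reach⇒crossing S (connected v t (lookup≡false⇒∉ Iv) t∉I)
                                    (VecP.[]=⇒lookup v∈S) (∉⇒lookup≡false t∉S)
  ...   | e , Fe≢0 , e∈δS = ⊥-elim (ℕP.n≮n 0 (subst (1 ℕ.≤_) cut≡0 (crossing⇒1≤cut S e Fe≢0 e∈δS)))

-- The primal point of (L.P.3) defined by a connected T-join

module JoinSolution {n m : ℕ} (src tgt : Fin m → Fin n) {T I : Subset n} {F : Fin m → ℕ} {t : Fin n}
                    (t∈T : t ∈ T) (I⊆∁T : I ⊆ ∁ T) (join : Graph.ConnectedTJoin src tgt T I F) where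
  open Graph src tgt
  open Cuts src tgt
  open ConnectedTJoins src tgt I⊆∁T join

  x : Fin m → ℚ
  x e = ℕ→ℚ (F e)

  t∉I : t ∉ I
  t∉I t∈I = x∈p⇒x∉∁p t∈T (I⊆∁T t∈I)

  odd-cut-covered : ∀ Q → Odd ∣ Q ∩ T ∣ → 1ℚ ≤ xδ x Q
  odd-cut-covered Q odd = subst (1ℚ ≤_) (sym (xδ-ℕ→ℚ F Q))
    (ℕ→ℚ-mono-≤ {1} {cut F Q} (isOdd⇒1≤ (trans (isOdd-cut≡isOdd-∣∩T∣ Q) (Odd⇒isOdd≡true _ odd))))

  coverage : Subset n → Subset n → ℚ
  coverage R X = if lookup X t then 0ℚ else (if ⌊ R ⊆? X ⌋ then (1ℚ + 1ℚ) * pointMass I X else 0ℚ)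

  coverage-nonNeg : ∀ R X → 0ℚ ≤ coverage R X
  coverage-nonNeg R X with lookup X t | ⌊ R ⊆? X ⌋ | ⌊ VecP.≡-dec BoolP._≟_ X I ⌋
  ... | true  | _     | _     = ℚP.≤-refl
  ... | false | false | _     = ℚP.≤-refl
  ... | false | true  | true  = *≤* (ℤ.+≤+ z≤n)
  ... | false | true  | false = ℚP.≤-refl

  coverage-at-I : ∀ {R} → R ⊆ I → coverage R I ≡ 1ℚ + 1ℚ
  coverage-at-I {R} R⊆I rewrite ∉⇒lookup≡false t∉I | ⌊⌋-true (R ⊆? I) R⊆I | pointMass-at I = refl

  -- A T-even cut is crossed 0 or ≥ 2 times; if 0, then R ⊆ I and the term Z_I contributes 2.
  even-cut-covered : ∀ R → t ∉ R → Even ∣ R ∩ T ∣ → 1ℚ + 1ℚ ≤ xδ x R + sumSubsets (coverage R)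
  even-cut-covered R t∉R even
    with Even⇒≡0⊎2≤ (isOdd≡false⇒Even _ (trans (isOdd-cut≡isOdd-∣∩T∣ R) (Even⇒isOdd≡false _ even)))
  ... | inj₁ cut≡0 = ≤-+-nonNegˡ (subst (0ℚ ≤_) (sym (xδ-ℕ→ℚ F R)) (ℕ→ℚ-nonNeg (cut F R)))
    (subst (_≤ sumSubsets (coverage R)) (coverage-at-I (cut≡0⇒⊆ t∉I t∉R cut≡0))
      (term≤sumSubsets (coverage R) (coverage-nonNeg R) I))
  ... | inj₂ 2≤cut = ≤-+-nonNegʳ (sumSubsets-nonNeg (coverage R) (coverage-nonNeg R))
    (subst (1ℚ + 1ℚ ≤_) (sym (xδ-ℕ→ℚ F R)) (ℕ→ℚ-mono-≤ {2} {cut F R} 2≤cut))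

  penalty : (Fin n → ℚ) → Subset n → ℚ
  penalty π X = if lookup X t then 0ℚ else weight π X * pointMass I X

  sumSubsets-penalty : ∀ π → sumSubsets (penalty π) ≡ weight π I
  sumSubsets-penalty π = trans (sumSubsets-concentrated (penalty π) I penalty-off) penalty-at-I
    where
      penalty-off : ∀ X → X ≢ I → penalty π X ≡ 0ℚ
      penalty-off X X≢I rewrite pointMass-off X≢I with lookup X t
      ... | true  = refl
      ... | false = ℚP.*-zeroʳ (weight π X)

      penalty-at-I : penalty π I ≡ weight π I
      penalty-at-I rewrite ∉⇒lookup≡false t∉I | pointMass-at I = ℚP.*-identityʳ (weight π I)

  objective≡ : ∀ c π → sumℚ (λ e → c e * x e) + sumSubsets (penalty π) ≡ costF c F + weight π I
  objective≡ c π = cong (costF c F +_) (sumSubsets-penalty π)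

mainTheorem8 : (n m : ℕ) (src tgt : Fin m → Fin n) (c : Fin m → ℚ) (T : Subset n) (π : Fin n → ℚ)
    (tstar : Fin n) →
    (∀ e → 0ℚ ≤ c e) → (∀ v → 0ℚ ≤ π v) →
    Even ∣ T ∣ → Nonempty T → tstar ∈ T →
    (I : Subset n) → I ⊆ ∁ T → (F : Fin m → ℕ) → Graph.ConnectedTJoin src tgt T I F →
    Σ (Fin m → ℚ) λ x → Σ (Subset n → ℚ) λ Z →
        (∀ e → 0ℚ ≤ x e)
      × (∀ X → 0ℚ ≤ Z X)
      × (∀ Q → tstar ∉ Q → Odd ∣ Q ∩ T ∣ → 1ℚ ≤ Graph.xδ src tgt x Q)
      × (∀ R → tstar ∉ R → Nonempty R → Even ∣ R ∩ T ∣ →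
           (1ℚ + 1ℚ) ≤ Graph.xδ src tgt x R
                       + sumSubsets (λ X → if lookup X tstar then 0ℚ
                                           else (if ⌊ R ⊆? X ⌋ then (1ℚ + 1ℚ) * Z X else 0ℚ)))
      × (sumℚ (λ e → c e * x e)
           + sumSubsets (λ X → if lookup X tstar then 0ℚ else Graph.weight src tgt π X * Z X)
         ≤ Graph.costF src tgt c F + Graph.weight src tgt π I)
mainTheorem8 n m src tgt c T π tstar _ _ _ _ tstar∈T I I⊆∁T F join =
    x , pointMass I
  , (λ e → ℕ→ℚ-nonNeg (F e))
  , pointMass-nonNeg I
  , (λ Q _ → odd-cut-covered Q)
  , (λ R tstar∉R _ → even-cut-covered R tstar∉R)
  , ℚP.≤-reflexive (objective≡ c π)
  where open JoinSolution src tgt tstar∈T I⊆∁T join
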